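{- Let $p\geq 3$ be a prime, let $F(\mathbb{Z}_p,p)=\{(g_1,\ldots,g_p)\in\mathbb{Z}_p^p : g_i\neq g_j \text{ for } i\neq j\}$, and let $\overline{F}(\mathbb{Z}_p,p)$ be the subgroup of $\mathbb{Z}_p^p$ generated by $F(\mathbb{Z}_p,p)$. Let $z_1,\ldots,z_p\in\overline{F}(\mathbb{Z}_p,p)$ with $z_i\neq z_j$ for $i\neq j$, and let $A\in M_p(\mathbb{Z}_p)$ be the $p\times p$ matrix whose $i$-th column is $z_i^T$. Then the system $Ax=0$ admits a nontrivial solution $x\in\mathbb{Z}_p^p$. -}

module Defs where

open import Data.Nat using (ℕ; zero; suc; NonZero) renaming (_+_ to _+ℕ_; _*_ to _*ℕ_; _∸_ to _∸ℕ_)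
open import Data.Nat.DivMod using (_mod_)
open import Data.Fin using (Fin; toℕ) renaming (zero to fzero; suc to fsuc)
open import Relation.Binary.PropositionalEquality using (_≡_; _≢_)
open import Relation.Nullary using (¬_)

ZMod : ℕ → Set
ZMod p = Fin p

module _ (p : ℕ) .{{_ : NonZero p}} where

  0ₚ : ZMod p
  0ₚ = 0 mod p

  _+ₚ_ : ZMod p → ZMod p → ZMod p
  a +ₚ b = (toℕ a +ℕ toℕ b) mod p

  _*ₚ_ : ZMod p → ZMod p → ZMod p
  a *ₚ b = (toℕ a *ℕ toℕ b) mod p

  -ₚ_ : ZMod p → ZMod p
  -ₚ a = (p ∸ℕ toℕ a) mod p

  sumₚ : (n : ℕ) → (Fin n → ZMod p) → ZMod p
  sumₚ zero f = 0ₚ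
  sumₚ (suc n) f = f fzero +ₚ sumₚ n (λ i → f (fsuc i))

  Vecₚ : Set
  Vecₚ = Fin p → ZMod p

  0ᵥ : Vecₚ
  0ᵥ _ = 0ₚ

  _+ᵥ_ : Vecₚ → Vecₚ → Vecₚ
  (u +ᵥ v) k = u k +ₚ v k

  -ᵥ_ : Vecₚ → Vecₚ
  (-ᵥ u) k = -ₚ u k

  InF : Vecₚ → Set
  InF g = ∀ i j → i ≢ j → g i ≢ g j

  data InFbar : Vecₚ → Set where
    gen  : ∀ {g} → InF g → InFbar g
    zer  : InFbar 0ᵥ
    add  : ∀ {u v} → InFbar u → InFbar v → InFbar (u +ᵥ v)
    neg  : ∀ {u} → InFbar u → InFbar (-ᵥ u)

  _≠ᵥ_ : Vecₚ → Vecₚ → Set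
  u ≠ᵥ v = ¬ (∀ k → u k ≡ v k)

-- Every element of F(ℤ_p, p) is a permutation of ℤ_p, so its coordinates add up to
-- 0 + 1 + ⋯ + (p − 1); negation permutes ℤ_p, so this sum S satisfies S = −S, and
-- since 2 is invertible S = 0. Coordinate sums are additive, hence vanish on all of
-- F̄(ℤ_p, p): the rows of A add up to zero. So the p columns of A lie in the
-- hyperplane {Σ_j y_j = 0} ≅ ℤ_p^(p−1), and p vectors in a space of dimension p − 1
-- over an integral domain are linearly dependent (Gaussian elimination).
module Submission where

open import Defs
open import Algebra.Bundles using (AbelianGroup; CommutativeRing)
open import Algebra.Consequences.Propositional using (comm∧idˡ⇒id; comm∧invˡ⇒inv; comm∧distrˡ⇒distr)
open import Data.Fin using (Fin; toℕ; punchIn; punchOut) renaming (zero to fzero; suc to fsuc)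
open import Data.Fin.Permutation using (Permutation)
open import Data.Fin.Properties
  using (any?; pigeonhole; punchIn-punchOut; punchOut-injective; <⇒≢; toℕ-fromℕ<; toℕ-injective; toℕ<n)
  renaming (_≟_ to _≟ᶠ_)
open import Data.Nat using (ℕ; zero; suc; NonZero; _≤_; _<_; >-nonZero⁻¹) renaming (_+_ to _+ℕ_; _*_ to _*ℕ_; _∸_ to _∸ℕ_)
open import Data.Nat.DivMod using (_mod_; _%_; m<n⇒m%n≡m; %-distribˡ-+; %-distribˡ-*; [m+n]%n≡m%n)
open import Data.Nat.Divisibility using (_∣_; m%n≡0⇒n∣m; n∣m⇒m%n≡0; >⇒∤)
open import Data.Nat.Primality using (Prime; euclidsLemma)
import Data.Nat.Properties as ℕ
open import Data.Empty using (⊥-elim)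
open import Data.Product using (Σ; ∃; _×_; _,_; proj₁; proj₂)
open import Data.Sum using (_⊎_; inj₁; inj₂; fromInj₂)
open import Function using (id; _∘_)
open import Function.Bundles using (mk↔ₛ′)
open import Function.Definitions using (Injective)
open import Level using (0ℓ)
open import Relation.Binary.Definitions using (Decidable)
open import Relation.Binary.PropositionalEquality as ≡ using (_≡_; _≢_)
open import Relation.Nullary using (yes; no; ¬?; contradiction)
open import Relation.Nullary.Decidable using (decidable-stable)

module AbelianGroupSum {c ℓ} (G : AbelianGroup c ℓ) where
  open AbelianGroup G
  open import Algebra.Properties.AbelianGroup G using (ε⁻¹≈ε; ⁻¹-∙-comm)
  open import Algebra.Properties.CommutativeMonoid.Sum commutativeMonoid using (sum)

  ⁻¹-distrib-sum : ∀ {n} (f : Fin n → Carrier) → sum f ⁻¹ ≈ sum (λ i → f i ⁻¹)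
  ⁻¹-distrib-sum {zero}  f = ε⁻¹≈ε
  ⁻¹-distrib-sum {suc n} f = trans (sym (⁻¹-∙-comm _ _)) (∙-congˡ (⁻¹-distrib-sum (f ∘ fsuc)))

module LinearDependence {c ℓ} (R : CommutativeRing c ℓ) where
  open CommutativeRing R
  open import Algebra.Properties.Ring ring using (-0#≈0#; -‿distribˡ-*; -‿distribʳ-*; +-inverseˡ-unique; [y-z]x≈yx-zx)
  open import Algebra.Properties.CommutativeMonoid.Sum +-commutativeMonoid
    using (sum; sum-cong-≋; sum-replicate-zero; ∑-distrib-+; ∑-comm)
  open import Algebra.Properties.Semiring.Sum semiring using (*-distribˡ-sum; *-distribʳ-sum)
  open AbelianGroupSum +-abelianGroup renaming (⁻¹-distrib-sum to -‿distrib-sum)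
  open import Relation.Binary.Reasoning.Setoid setoid

  IsNontrivialRelation : ∀ {m n} → (Fin m → Fin n → Carrier) → (Fin m → Carrier) → Set ℓ
  IsNontrivialRelation v x = (∃ λ i → x i ≉ 0#) × (∀ j → sum (λ i → v i j * x i) ≈ 0#)

  sum-zeros : ∀ {n} {f : Fin n → Carrier} → (∀ i → f i ≈ 0#) → sum f ≈ 0#
  sum-zeros {n} f≈0 = trans (sum-cong-≋ f≈0) (sum-replicate-zero n)

  relation-from-zero-sums : ∀ {m n} (z : Fin m → Fin (suc n) → Carrier) {x : Fin m → Carrier} →
                            (∀ i → sum (z i) ≈ 0#) → (∀ j → sum (λ i → z i (fsuc j) * x i) ≈ 0#) →
                            sum (λ i → z i fzero * x i) ≈ 0#
  relation-from-zero-sums z {x} z-sum≈0 relation = begin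
    sum (λ i → z i fzero * x i)
      ≈⟨ sum-cong-≋ (λ i → *-congʳ (+-inverseˡ-unique _ _ (z-sum≈0 i))) ⟩
    sum (λ i → - sum (z i ∘ fsuc) * x i)
      ≈⟨ sum-cong-≋ (λ i → -‿distribˡ-* (sum (z i ∘ fsuc)) (x i)) ⟨
    sum (λ i → - (sum (z i ∘ fsuc) * x i))
      ≈⟨ -‿distrib-sum (λ i → sum (z i ∘ fsuc) * x i) ⟨
    - sum (λ i → sum (z i ∘ fsuc) * x i)
      ≈⟨ -‿cong (sum-cong-≋ (λ i → *-distribʳ-sum (x i) (z i ∘ fsuc))) ⟩
    - sum (λ i → sum (λ j → z i (fsuc j) * x i))
      ≈⟨ -‿cong (∑-comm (λ i j → z i (fsuc j) * x i)) ⟩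
    - sum (λ j → sum (λ i → z i (fsuc j) * x i))
      ≈⟨ -‿cong (sum-zeros {f = λ j → sum (λ i → z i (fsuc j) * x i)} relation) ⟩
    - 0#
      ≈⟨ -0#≈0# ⟩
    0# ∎

  module OverIntegralDomain (_≟_ : Decidable _≈_) (1≉0 : 1# ≉ 0#)
           (x*y≈0⇒x≈0∨y≈0 : ∀ {x y} → x * y ≈ 0# → x ≈ 0# ⊎ y ≈ 0#) where

    zero-first⇒dependent : ∀ {m n} (v : Fin (suc m) → Fin n → Carrier) →
                           (∀ j → v fzero j ≈ 0#) → ∃ (IsNontrivialRelation v)
    zero-first⇒dependent v v₀≈0 = e₀ , (fzero , 1≉0) , relation
      where
      e₀ : Fin _ → Carrier
      e₀ fzero    = 1#
      e₀ (fsuc _) = 0#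
      relation : ∀ j → sum (λ i → v i j * e₀ i) ≈ 0#
      relation j = trans (+-cong (trans (*-identityʳ _) (v₀≈0 j))
                                 (sum-zeros {f = λ i → v (fsuc i) j * 0#} (λ i → zeroʳ _)))
                         (+-identityʳ 0#)

    relation-over-zero-coordinate :
      ∀ {m n} (w : Fin m → Fin (suc n) → Carrier) (j₀ : Fin (suc n)) {y : Fin m → Carrier} →
      (∀ i → w i j₀ ≈ 0#) → IsNontrivialRelation (λ i j → w i (punchIn j₀ j)) y →
      IsNontrivialRelation w y
    relation-over-zero-coordinate w j₀ {y} w≈0 (y≉0 , relation) = y≉0 , relation′
      where
      relation′ : ∀ j → sum (λ i → w i j * y i) ≈ 0#
      relation′ j with j₀ ≟ᶠ j
      ... | yes ≡.refl = sum-zeros (λ i → trans (*-congʳ (w≈0 i)) (zeroˡ (y i)))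
      ... | no j₀≢j  = ≡.subst (λ j → sum (λ i → w i j * y i) ≈ 0#)
                               (punchIn-punchOut j₀≢j) (relation _)

    -- Fraction-free Gaussian elimination with pivot v 0 j₀.
    eliminate : ∀ {m n} → (Fin (suc m) → Fin n → Carrier) → Fin n → Fin m → Fin n → Carrier
    eliminate v j₀ i j = v fzero j₀ * v (fsuc i) j - v (fsuc i) j₀ * v fzero j

    eliminate-vanishes : ∀ {m n} (v : Fin (suc m) → Fin n → Carrier) j₀ i →
                         eliminate v j₀ i j₀ ≈ 0#
    eliminate-vanishes v j₀ i =
      trans (+-congˡ (-‿cong (*-comm _ _))) (-‿inverseʳ _)

    back-substitute : ∀ {m n} (v : Fin (suc m) → Fin n → Carrier) {j₀} →
                      v fzero j₀ ≉ 0# → ∀ {y} → IsNontrivialRelation (eliminate v j₀) y →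
                      ∃ (IsNontrivialRelation v)
    back-substitute {m} v {j₀} k≉0 {y} ((i₀ , y≉0) , relation) = x , (fsuc i₀ , x≉0) , relation′
      where
      k = v fzero j₀
      b : Fin m → Carrier
      b i = v (fsuc i) j₀
      x : Fin (suc m) → Carrier
      x fzero    = - sum (λ i → b i * y i)
      x (fsuc i) = k * y i
      x≉0 : x (fsuc i₀) ≉ 0#
      x≉0 ky≈0 with x*y≈0⇒x≈0∨y≈0 ky≈0
      ... | inj₁ k≈0 = k≉0 k≈0
      ... | inj₂ y≈0 = y≉0 y≈0
      regroup : ∀ j i → eliminate v j₀ i j * y i ≈ v (fsuc i) j * x (fsuc i) - v fzero j * (b i * y i)
      regroup j i = trans ([y-z]x≈yx-zx (y i) _ _)
        (+-cong (trans (*-congʳ (*-comm _ _)) (*-assoc _ _ _))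
                (-‿cong (trans (*-congʳ (*-comm _ _)) (*-assoc _ _ _))))
      relation′ : ∀ j → sum (λ i → v i j * x i) ≈ 0#
      relation′ j = begin
        v fzero j * x fzero + sum (λ i → v (fsuc i) j * x (fsuc i))
          ≈⟨ +-comm _ _ ⟩
        sum (λ i → v (fsuc i) j * x (fsuc i)) + v fzero j * - sum (λ i → b i * y i)
          ≈⟨ +-congˡ (trans (sym (-‿distribʳ-* _ _)) (-‿cong (*-distribˡ-sum (v fzero j) (λ i → b i * y i)))) ⟩
        sum (λ i → v (fsuc i) j * x (fsuc i)) - sum (λ i → v fzero j * (b i * y i))
          ≈⟨ +-congˡ (-‿distrib-sum (λ i → v fzero j * (b i * y i))) ⟩
        sum (λ i → v (fsuc i) j * x (fsuc i)) + sum (λ i → - (v fzero j * (b i * y i)))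
          ≈⟨ ∑-distrib-+ (λ i → v (fsuc i) j * x (fsuc i)) (λ i → - (v fzero j * (b i * y i))) ⟨
        sum (λ i → v (fsuc i) j * x (fsuc i) - v fzero j * (b i * y i))
          ≈⟨ sum-cong-≋ (regroup j) ⟨
        sum (λ i → eliminate v j₀ i j * y i)
          ≈⟨ relation j ⟩
        0# ∎

    1+n-vectors-dependent : ∀ n (v : Fin (suc n) → Fin n → Carrier) → ∃ (IsNontrivialRelation v)
    1+n-vectors-dependent zero    v = (λ _ → 1#) , (fzero , 1≉0) , λ ()
    1+n-vectors-dependent (suc n) v with any? (λ j → ¬? (v fzero j ≟ 0#))
    ... | no ¬∃v₀≉0 =
      zero-first⇒dependent v (λ j → decidable-stable (v fzero j ≟ 0#) (¬∃v₀≉0 ∘ (j ,_)))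
    ... | yes (j₀ , k≉0) =
      let y , relation = 1+n-vectors-dependent n (λ i j → eliminate v j₀ i (punchIn j₀ j))
      in back-substitute v k≉0
           (relation-over-zero-coordinate (eliminate v j₀) j₀ (eliminate-vanishes v j₀) relation)

    zero-sum-vectors-dependent : ∀ n (z : Fin (suc n) → Fin (suc n) → Carrier) →
                                 (∀ i → sum (z i) ≈ 0#) → ∃ (IsNontrivialRelation z)
    zero-sum-vectors-dependent n z z-sum≈0 =
      let x , x≉0 , relation = 1+n-vectors-dependent n (λ i → z i ∘ fsuc)
      in x , x≉0 , λ { fzero → relation-from-zero-sums z {x} z-sum≈0 relation ; (fsuc j) → relation j }

module ZModRing (p : ℕ) .{{_ : NonZero p}} where
  open ≡ using (refl; sym; trans; cong; cong₂; isEquivalence)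
  open ≡.≡-Reasoning

  infixl 6 _+_
  infixl 7 _*_
  infix  8 -_

  _+_ _*_ : ZMod p → ZMod p → ZMod p
  _+_ = _+ₚ_ p
  _*_ = _*ₚ_ p

  -_ : ZMod p → ZMod p
  -_ = -ₚ_ p

  0# 1# : ZMod p
  0# = 0ₚ p
  1# = 1 mod p

  toℕ-mod : ∀ m → toℕ (m mod p) ≡ m % p
  toℕ-mod m = toℕ-fromℕ< _

  mod-toℕ : ∀ a → toℕ a mod p ≡ a
  mod-toℕ a = toℕ-injective (trans (toℕ-mod (toℕ a)) (m<n⇒m%n≡m (toℕ<n a)))

  mod-cong : ∀ {m n} → m % p ≡ n % p → m mod p ≡ n mod p
  mod-cong eq = toℕ-injective (trans (toℕ-mod _) (trans eq (sym (toℕ-mod _))))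

  mod-+ : ∀ m n → (m mod p) + (n mod p) ≡ (m +ℕ n) mod p
  mod-+ m n = mod-cong (begin
    (toℕ (m mod p) +ℕ toℕ (n mod p)) % p ≡⟨ cong₂ (λ a b → (a +ℕ b) % p) (toℕ-mod m) (toℕ-mod n) ⟩
    (m % p +ℕ n % p) % p                 ≡⟨ %-distribˡ-+ m n p ⟨
    (m +ℕ n) % p                         ∎)

  mod-* : ∀ m n → (m mod p) * (n mod p) ≡ (m *ℕ n) mod p
  mod-* m n = mod-cong (begin
    (toℕ (m mod p) *ℕ toℕ (n mod p)) % p ≡⟨ cong₂ (λ a b → (a *ℕ b) % p) (toℕ-mod m) (toℕ-mod n) ⟩
    (m % p *ℕ (n % p)) % p               ≡⟨ %-distribˡ-* m n p ⟨
    (m *ℕ n) % p                         ∎)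

  +-assoc : ∀ a b c → (a + b) + c ≡ a + (b + c)
  +-assoc a b c = begin
    (a + b) + c                               ≡⟨ cong ((a + b) +_) (mod-toℕ c) ⟨
    (toℕ a +ℕ toℕ b) mod p + toℕ c mod p      ≡⟨ mod-+ (toℕ a +ℕ toℕ b) (toℕ c) ⟩
    (toℕ a +ℕ toℕ b +ℕ toℕ c) mod p           ≡⟨ cong (_mod p) (ℕ.+-assoc (toℕ a) (toℕ b) (toℕ c)) ⟩
    (toℕ a +ℕ (toℕ b +ℕ toℕ c)) mod p         ≡⟨ mod-+ (toℕ a) (toℕ b +ℕ toℕ c) ⟨
    toℕ a mod p + (toℕ b +ℕ toℕ c) mod p      ≡⟨ cong (_+ (b + c)) (mod-toℕ a) ⟩
    a + (b + c)                               ∎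

  *-assoc : ∀ a b c → (a * b) * c ≡ a * (b * c)
  *-assoc a b c = begin
    (a * b) * c                               ≡⟨ cong ((a * b) *_) (mod-toℕ c) ⟨
    (toℕ a *ℕ toℕ b) mod p * (toℕ c mod p)    ≡⟨ mod-* (toℕ a *ℕ toℕ b) (toℕ c) ⟩
    (toℕ a *ℕ toℕ b *ℕ toℕ c) mod p           ≡⟨ cong (_mod p) (ℕ.*-assoc (toℕ a) (toℕ b) (toℕ c)) ⟩
    (toℕ a *ℕ (toℕ b *ℕ toℕ c)) mod p         ≡⟨ mod-* (toℕ a) (toℕ b *ℕ toℕ c) ⟨
    toℕ a mod p * ((toℕ b *ℕ toℕ c) mod p)    ≡⟨ cong (_* (b * c)) (mod-toℕ a) ⟩
    a * (b * c)                               ∎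

  +-comm : ∀ a b → a + b ≡ b + a
  +-comm a b = cong (_mod p) (ℕ.+-comm (toℕ a) (toℕ b))

  *-comm : ∀ a b → a * b ≡ b * a
  *-comm a b = cong (_mod p) (ℕ.*-comm (toℕ a) (toℕ b))

  +-identityˡ : ∀ a → 0# + a ≡ a
  +-identityˡ a = begin
    0# + a              ≡⟨ cong (0# +_) (mod-toℕ a) ⟨
    0# + toℕ a mod p    ≡⟨ mod-+ 0 (toℕ a) ⟩
    toℕ a mod p         ≡⟨ mod-toℕ a ⟩
    a                   ∎

  *-identityˡ : ∀ a → 1# * a ≡ a
  *-identityˡ a = begin
    1# * a                ≡⟨ cong (1# *_) (mod-toℕ a) ⟨
    1# * (toℕ a mod p)    ≡⟨ mod-* 1 (toℕ a) ⟩
    (1 *ℕ toℕ a) mod p    ≡⟨ cong (_mod p) (ℕ.*-identityˡ (toℕ a)) ⟩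
    toℕ a mod p           ≡⟨ mod-toℕ a ⟩
    a                     ∎

  -‿inverseˡ : ∀ a → - a + a ≡ 0#
  -‿inverseˡ a = begin
    - a + a                       ≡⟨ cong (- a +_) (mod-toℕ a) ⟨
    - a + toℕ a mod p             ≡⟨ mod-+ (p ∸ℕ toℕ a) (toℕ a) ⟩
    (p ∸ℕ toℕ a +ℕ toℕ a) mod p   ≡⟨ cong (_mod p) (ℕ.m∸n+n≡m (ℕ.<⇒≤ (toℕ<n a))) ⟩
    p mod p                       ≡⟨ mod-cong ([m+n]%n≡m%n 0 p) ⟩
    0#                            ∎

  *-distribˡ-+ : ∀ a b c → a * (b + c) ≡ a * b + a * c
  *-distribˡ-+ a b c = begin
    a * (b + c)                                 ≡⟨ cong (_* (b + c)) (mod-toℕ a) ⟨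
    (toℕ a mod p) * (b + c)                     ≡⟨ mod-* (toℕ a) (toℕ b +ℕ toℕ c) ⟩
    (toℕ a *ℕ (toℕ b +ℕ toℕ c)) mod p           ≡⟨ cong (_mod p) (ℕ.*-distribˡ-+ (toℕ a) (toℕ b) (toℕ c)) ⟩
    (toℕ a *ℕ toℕ b +ℕ toℕ a *ℕ toℕ c) mod p    ≡⟨ mod-+ (toℕ a *ℕ toℕ b) (toℕ a *ℕ toℕ c) ⟨
    a * b + a * c                               ∎

  +-*-commutativeRing : CommutativeRing 0ℓ 0ℓ
  +-*-commutativeRing = record
    { Carrier = ZMod p ; _≈_ = _≡_ ; _+_ = _+_ ; _*_ = _*_ ; -_ = -_ ; 0# = 0# ; 1# = 1#
    ; isCommutativeRing = record
      { isRing = record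
        { +-isAbelianGroup = record
          { isGroup = record
            { isMonoid = record
              { isSemigroup = record
                { isMagma = record { isEquivalence = isEquivalence ; ∙-cong = cong₂ _+_ }
                ; assoc   = +-assoc }
              ; identity = comm∧idˡ⇒id +-comm +-identityˡ }
            ; inverse = comm∧invˡ⇒inv +-comm -‿inverseˡ
            ; ⁻¹-cong = cong -_ }
          ; comm = +-comm }
        ; *-cong     = cong₂ _*_
        ; *-assoc    = *-assoc
        ; *-identity = comm∧idˡ⇒id *-comm *-identityˡ
        ; distrib    = comm∧distrˡ⇒distr (cong₂ _+_) *-comm *-distribˡ-+ }
      ; *-comm = *-comm } }

  open CommutativeRing +-*-commutativeRing using (+-commutativeMonoid)
  open import Algebra.Properties.CommutativeMonoid.Sum +-commutativeMonoid using (sum)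

  sum≡sumₚ : ∀ m (f : Fin m → ZMod p) → sum f ≡ sumₚ p m f
  sum≡sumₚ zero    f = refl
  sum≡sumₚ (suc m) f = cong (f fzero +_) (sum≡sumₚ m (f ∘ fsuc))

  toℕ-0# : toℕ 0# ≡ 0
  toℕ-0# = trans (toℕ-mod 0) (m<n⇒m%n≡m (>-nonZero⁻¹ p))

  mod≡0#⇒∣ : ∀ m → m mod p ≡ 0# → p ∣ m
  mod≡0#⇒∣ m m≡0 = m%n≡0⇒n∣m m p (trans (sym (toℕ-mod m)) (trans (cong toℕ m≡0) toℕ-0#))

  mod≢0# : ∀ m .{{_ : NonZero m}} → m < p → m mod p ≢ 0#
  mod≢0# m m<p = >⇒∤ m<p ∘ mod≡0#⇒∣ m

  ∣toℕ⇒≡0# : ∀ a → p ∣ toℕ a → a ≡ 0#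
  ∣toℕ⇒≡0# a p∣a = toℕ-injective (begin
    toℕ a       ≡⟨ m<n⇒m%n≡m (toℕ<n a) ⟨
    toℕ a % p   ≡⟨ n∣m⇒m%n≡0 (toℕ a) p p∣a ⟩
    0           ≡⟨ toℕ-0# ⟨
    toℕ 0#      ∎)

injective⇒surjective : ∀ {n} (g : Fin n → Fin n) → Injective _≡_ _≡_ g → ∀ y → ∃ λ x → g x ≡ y
injective⇒surjective {suc n} g g-inj y with any? (λ x → g x ≟ᶠ y)
... | yes hit = hit
... | no miss with i , j , i<j , gᵢ≡gⱼ ← pigeonhole (ℕ.n<1+n n) (λ x → punchOut (miss ∘ (x ,_) ∘ ≡.sym))
  = contradiction (g-inj (punchOut-injective {i = y} _ _ gᵢ≡gⱼ)) (<⇒≢ i<j)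

injective⇒permutation : ∀ {n} (g : Fin n → Fin n) → Injective _≡_ _≡_ g → Permutation n n
injective⇒permutation g g-inj =
  mk↔ₛ′ g (proj₁ ∘ surjective) (proj₂ ∘ surjective) (λ x → g-inj (proj₂ (surjective (g x))))
  where surjective = injective⇒surjective g g-inj

InF⇒injective : ∀ {p} .{{_ : NonZero p}} {g} → InF p g → Injective _≡_ _≡_ g
InF⇒injective g∈F {i} {j} gᵢ≡gⱼ = decidable-stable (i ≟ᶠ j) (λ i≢j → g∈F i j i≢j gᵢ≡gⱼ)

module ZModPrime (p : ℕ) .{{_ : NonZero p}} (p-prime : Prime p) (3≤p : 3 ≤ p) where
  open ZModRing p
  module ℤₚ = CommutativeRing +-*-commutativeRing
  open import Algebra.Properties.Ring ℤₚ.ring using (-0#≈0#; -‿involutive)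
  open import Algebra.Properties.CommutativeMonoid.Sum ℤₚ.+-commutativeMonoid
    using (sum; sum-permute; sum-replicate-zero; ∑-distrib-+)
  open AbelianGroupSum ℤₚ.+-abelianGroup renaming (⁻¹-distrib-sum to -‿distrib-sum)
  open ≡ using (sym; trans; cong; cong₂)
  open ≡.≡-Reasoning

  x*y≡0⇒x≡0∨y≡0 : ∀ {a b} → a * b ≡ 0# → a ≡ 0# ⊎ b ≡ 0#
  x*y≡0⇒x≡0∨y≡0 {a} {b} ab≡0 with euclidsLemma (toℕ a) (toℕ b) p-prime (mod≡0#⇒∣ _ ab≡0)
  ... | inj₁ p∣a = inj₁ (∣toℕ⇒≡0# a p∣a)
  ... | inj₂ p∣b = inj₂ (∣toℕ⇒≡0# b p∣b)

  1#≢0# : 1# ≢ 0#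
  1#≢0# = mod≢0# 1 (ℕ.<-≤-trans (ℕ.n<1+n 1) (ℕ.<⇒≤ 3≤p))

  1#+1#≢0# : 1# + 1# ≢ 0#
  1#+1#≢0# 2≡0 = mod≢0# 2 3≤p (trans (sym (mod-+ 1 1)) 2≡0)

  x+x≡0⇒x≡0 : ∀ a → a + a ≡ 0# → a ≡ 0#
  x+x≡0⇒x≡0 a a+a≡0 = fromInj₂ (⊥-elim ∘ 1#+1#≢0#) (x*y≡0⇒x≡0∨y≡0 (begin
    (1# + 1#) * a      ≡⟨ ℤₚ.distribʳ a 1# 1# ⟩
    1# * a + 1# * a    ≡⟨ cong₂ _+_ (*-identityˡ a) (*-identityˡ a) ⟩
    a + a              ≡⟨ a+a≡0 ⟩
    0#                 ∎))

  sum-residues≡0# : sum id ≡ 0#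
  sum-residues≡0# = x+x≡0⇒x≡0 (sum id) (begin
    sum id + sum id               ≡⟨ cong (sum id +_) (sum-permute id negation) ⟩
    sum id + sum (λ a → - a)      ≡⟨ cong (sum id +_) (-‿distrib-sum id) ⟨
    sum id + - sum id             ≡⟨ ℤₚ.-‿inverseʳ (sum id) ⟩
    0#                            ∎)
    where
    negation : Permutation p p
    negation = mk↔ₛ′ -_ -_ -‿involutive -‿involutive

  InF⇒sum≡0# : ∀ {g} → InF p g → sum g ≡ 0#
  InF⇒sum≡0# {g} g∈F =
    trans (sym (sum-permute id (injective⇒permutation g (InF⇒injective g∈F)))) sum-residues≡0#

  InFbar⇒sum≡0# : ∀ {g} → InFbar p g → sum g ≡ 0#
  InFbar⇒sum≡0# (gen g∈F)             = InF⇒sum≡0# g∈F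
  InFbar⇒sum≡0# zer                   = sum-replicate-zero p
  InFbar⇒sum≡0# (add {u} {v} u∈F̄ v∈F̄) = begin
    sum (λ i → u i + v i)  ≡⟨ ∑-distrib-+ u v ⟩
    sum u + sum v          ≡⟨ cong₂ _+_ (InFbar⇒sum≡0# u∈F̄) (InFbar⇒sum≡0# v∈F̄) ⟩
    0# + 0#                ≡⟨ +-identityˡ 0# ⟩
    0#                     ∎
  InFbar⇒sum≡0# (neg {u} u∈F̄)         = begin
    sum (λ i → - u i)  ≡⟨ -‿distrib-sum u ⟨
    - sum u            ≡⟨ cong -_ (InFbar⇒sum≡0# u∈F̄) ⟩
    - 0#               ≡⟨ -0#≈0# ⟩
    0#                 ∎

corollary3p4 : (p : ℕ) .{{_ : NonZero p}} → Prime p → 3 ≤ p →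
    (z : Fin p → Vecₚ p) →
    (∀ i → InFbar p (z i)) →
    (∀ i j → i ≢ j → _≠ᵥ_ p (z i) (z j)) →
    Σ (Vecₚ p) (λ x →
      (∃ λ i → x i ≢ 0ₚ p) ×
      (∀ j → sumₚ p p (λ i → _*ₚ_ p (z i j) (x i)) ≡ 0ₚ p))
corollary3p4 (suc n) p-prime 3≤p z z∈F̄ _ =
  let x , x≢0 , Az≡0 = zero-sum-vectors-dependent n z (InFbar⇒sum≡0# ∘ z∈F̄)
  in x , x≢0 , λ j → ≡.trans (≡.sym (sum≡sumₚ (suc n) (λ i → z i j * x i))) (Az≡0 j)
  where
  open ZModRing (suc n)
  open ZModPrime (suc n) p-prime 3≤p
  open LinearDependence.OverIntegralDomain +-*-commutativeRing _≟ᶠ_ 1#≢0# x*y≡0⇒x≡0∨y≡0
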